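{- Assume the setting described in the context, and suppose $s+k_r\le n$ and $r(s-r+1)\le b-1$. Then the functions $g^{x,y}$, $0\le x\le s-r$, $1\le y\le\binom{n}{x}_q$, are linearly independent in the function space $\mathbb{F}_p^{\Omega}$ over $\mathbb{F}_p$.
   Context: Setting: $V$ is an $n$-dimensional vector space over $\mathbb{F}_q$; $b$ is a positive integer; $K=\{k_1<\cdots<k_r\}$ and $L=\{\mu_1,\ldots,\mu_s\}$ are disjoint subsets of $\{0,\ldots,b-1\}$; it is not the case that ($q+1$ is a power of $2$ and $b=2$), and not the case that ($q=2$, $b=6$). $p$ is a prime with $q^b\equiv1\pmod p$ and $q^i\not\equiv 1\pmod p$ for $0<i<b$ (which exists by Zsigmondy's theorem). $\binom{a}{d}_q$ is the $q$-binomial coefficient (zero if $d<0$ or $d>a$). Fix an ordering of the subspaces of $V$ of each dimension, so each subspace is $V_{d,e}$, the $e$-th subspace of dimension $d$ ($1\le e\le\binom{n}{d}_q$); pairs $\langle d,e\rangle$ are ordered first by $d$ then by $e$. Let $S=\sum_{t=0}^s\binom{n}{t}_q$ and $\Omega=\mathbb{F}_2^S$, with coordinates of $v\in\Omega$ indexed as $v^{x,y}$, $0\le x\le s$, $1\le y\le\binom{n}{x}_q$. For $0\le x\le s$, $f^{x,y}:\Omega\to\mathbb{F}_p$ is $f^{x,y}(v)=v^{x,y}$ (viewing $0,1$ in $\mathbb{F}_p$). For $0\le x\le s-r$, $g^{x,y}:\Omega\to\mathbb{F}_p$ is $g^{x,y}(v)=f^{x,y}(v)\prod_{t\in[r]}\left(\sum_{j=1}^{\binom{n}{1}_q}v^{1,j}-\binom{k_t}{1}_q\right)$,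 computed in $\mathbb{F}_p$. -}

module Defs where

open import Data.Nat as ℕ using (ℕ; zero; suc; _^_; _≤_; _<_; _≤?_)
open import Data.Nat.Primality using (Prime)
open import Data.Integer as ℤ using (ℤ; +_; _-_)
open import Data.Fin using (Fin; zero; suc; toℕ)
open import Data.Bool using (Bool; true; false; if_then_else_)
open import Data.Product using (Σ; _×_; ∃-syntax)
open import Relation.Nullary using (does)

-- q-binomial coefficient [a choose d]_q, via the q-Pascal rule
--   [a+1, d+1]_q = [a, d]_q + q^(d+1) [a, d+1]_q ,  [a,0]_q = 1, [0,d+1]_q = 0.
qbin : ℕ → ℕ → ℕ → ℕ
qbin q zero    zero    = 1
qbin q zero    (suc d) = 0
qbin q (suc a) zero    = 1
qbin q (suc a) (suc d) = qbin q a d ℕ.+ q ^ suc d ℕ.* qbin q a (suc d)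

IsPrimePower : ℕ → Set
IsPrimePower q = ∃[ ℓ ] ∃[ m ] (Prime ℓ × 1 ≤ m × q ≡' ℓ ^ m)
  where
  open import Relation.Binary.PropositionalEquality using () renaming (_≡_ to _≡'_)

sumℤ : (n : ℕ) → (Fin n → ℤ) → ℤ
sumℤ zero    f = + 0
sumℤ (suc n) f = f zero ℤ.+ sumℤ n (λ i → f (suc i))

prodℤ : (n : ℕ) → (Fin n → ℤ) → ℤ
prodℤ zero    f = + 1
prodℤ (suc n) f = f zero ℤ.* prodℤ n (λ i → f (suc i))

-- Ω = F₂^S, S = Σ_{t=0}^{s} [n,t]_q ; coordinates v^{x,y}, 0 ≤ x ≤ s, y < [n,x]_q
Ω : (q n s : ℕ) → Set
Ω q n s = (x : Fin (suc s)) → Fin (qbin q n (toℕ x)) → Bool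

bit : Bool → ℤ
bit true  = + 1
bit false = + 0

f : ∀ q n s (x : Fin (suc s)) → Fin (qbin q n (toℕ x)) → Ω q n s → ℤ
f q n s x y v = bit (v x y)

-- Σ_j v^{1,j}  (only meaningful when s ≥ 1; for s = 0 it is never used by a
-- member of the family)
level1Sum : ∀ q n s → Ω q n s → ℤ
level1Sum q n zero    v = + 0
level1Sum q n (suc s) v = sumℤ (qbin q n 1) (λ j → bit (v (suc zero) j))

-- g^{x,y}(v) = f^{x,y}(v) ∏_{t ∈ [r]} (Σ_j v^{1,j} − [k_t, 1]_q)   (computed in ℤ,
-- to be read modulo p)
g : ∀ q n s {r} (k : Fin r → ℕ) (x : Fin (suc s)) → Fin (qbin q n (toℕ x)) →
    Ω q n s → ℤ
g q n s {r} k x y v =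
  f q n s x y v ℤ.* prodℤ r (λ t → level1Sum q n s v - + qbin q (k t) 1)

combo : ∀ q n s {r} (k : Fin r → ℕ) →
        (c : (x : Fin (suc s)) → Fin (qbin q n (toℕ x)) → ℤ) → Ω q n s → ℤ
combo q n s {r} k c v =
  sumℤ (suc s) (λ x →
    if does (toℕ x ℕ.+ r ≤? s)
    then sumℤ (qbin q n (toℕ x)) (λ y → c x y ℤ.* g q n s k x y v)
    else + 0)

-- Write Λ(v) = Σ c_{x,y} v^{x,y} over x + r ≤ s and P(ℓ) = ∏_t (ℓ − [k_t]_q); then the
-- hypothesis says that p divides Σ c_{x,y} g^{x,y}(v) = Λ(v) · P(Σ_j v^{1,j}) for every v.
-- As p is a primitive prime divisor of q^b − 1, it divides neither q nor [d]_q for 0 < d < b;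
-- since [j]_q − [k]_q = q^k [j − k]_q for k < j, P([j]_q) is a unit mod p when j < b avoids
-- the k_t, and the bound r(s − r + 1) ≤ b − 1 provides such j among 0, …, r (or 1, …, r + 1).
-- For x ≠ 1, toggling v^{x,y} at a point of level-one weight [j]_q changes the sum by
-- c_{x,y} P([j]_q). For x = 1, points supported on level one give p ∣ Σ_y c_{1,y} w_y for all w
-- of weight m = [j]_q with j ≥ 1, so p ∤ m, and an averaging argument over the m-subsets of an
-- (m + 1)-set isolates each c_{1,y}. When r = 0, P = 1 and toggling works on every level.

module Submission where

open import Defs
open import Data.Nat using (ℕ; suc; _+_; _*_; _∸_; _^_; _≤_; _<_)
open import Data.Nat.Primality using (Prime)
open import Data.Integer using (ℤ; +_)
open import Data.Integer.Divisibility using () renaming (_∣_ to _∣ℤ_)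
open import Data.Nat.Divisibility using (_∣_)
open import Data.Fin using (Fin; toℕ)
open import Data.Product using (_×_; ∃-syntax)
open import Relation.Nullary using (¬_)
open import Relation.Binary.PropositionalEquality using (_≡_; _≢_)

open import Data.Bool using (Bool; true; false; if_then_else_)
open import Data.Empty using (⊥-elim)
open import Data.Fin using (zero; suc)
import Data.Fin as Fin
open import Data.Fin.Properties using (any?; pigeonhole; suc-injective; toℕ≤pred[n])
import Data.Integer as ℤ
import Data.Integer.Properties as ℤₚ
open import Algebra.Properties.AbelianGroup ℤₚ.+-0-abelianGroup
  using () renaming (∙-cancelˡ to +-cancelˡ; ∙-cancelʳ to +-cancelʳ)
open import Data.Integer.Divisibility.Signed
  using (divides; ∣ᵤ⇒∣; ∣⇒∣ᵤ; ∣m∣n⇒∣m+n; ∣m+n∣n⇒∣m; ∣n⇒∣m*n; ∣m⇒∣-m)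
  renaming (_∣_ to _∣ₛ_)
import Data.Integer.Tactic.RingSolver as ℤ-Solver
open import Data.Nat using (zero; z≤n; s≤s; _≤ᵇ_; >-nonZero)
import Data.Nat.Divisibility as ℕ∣
open import Data.Nat.Primality using (euclidsLemma; ¬prime[0]; ¬prime[1])
import Data.Nat.Properties as ℕ
import Data.Nat.Tactic.RingSolver as ℕ-Solver
open import Data.Product using (_,_; proj₁; proj₂)
open import Data.Sum using (_⊎_; [_,_]′)
import Data.Sum as Sum
open import Data.Vec.Functional using (updateAt)
open import Data.Vec.Functional.Properties using (updateAt-updates; updateAt-minimal)
open import Function using (_∘_; const; id)
open import Relation.Binary.Definitions using (tri<; tri≈; tri>)
open import Relation.Binary.PropositionalEquality
  using (refl; sym; trans; cong; cong₂; subst; module ≡-Reasoning)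
open import Relation.Nullary using (does; yes; no; contradiction; ¬?)
open import Relation.Nullary.Decidable using (dec-true; decidable-stable)

open ≡-Reasoning

sumℤ-cong : ∀ n {F G : Fin n → ℤ} → (∀ i → F i ≡ G i) → sumℤ n F ≡ sumℤ n G
sumℤ-cong zero    F≗G = refl
sumℤ-cong (suc n) F≗G = cong₂ ℤ._+_ (F≗G zero) (sumℤ-cong n (F≗G ∘ suc))

sumℤ-zero : ∀ n → sumℤ n (const (+ 0)) ≡ + 0
sumℤ-zero zero    = refl
sumℤ-zero (suc n) = trans (ℤₚ.+-identityˡ _) (sumℤ-zero n)

sumℤ-distrib-+ : ∀ n (F G : Fin n → ℤ) →
                 sumℤ n (λ i → F i ℤ.+ G i) ≡ sumℤ n F ℤ.+ sumℤ n G
sumℤ-distrib-+ zero    F G = refl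
sumℤ-distrib-+ (suc n) F G = begin
  (F zero ℤ.+ G zero) ℤ.+ sumℤ n (λ i → F (suc i) ℤ.+ G (suc i))
    ≡⟨ cong (ℤ._+_ (F zero ℤ.+ G zero)) (sumℤ-distrib-+ n (F ∘ suc) (G ∘ suc)) ⟩
  (F zero ℤ.+ G zero) ℤ.+ (sumℤ n (F ∘ suc) ℤ.+ sumℤ n (G ∘ suc))
    ≡⟨ interchange (F zero) (G zero) _ _ ⟩
  (F zero ℤ.+ sumℤ n (F ∘ suc)) ℤ.+ (G zero ℤ.+ sumℤ n (G ∘ suc)) ∎
  where
  interchange : ∀ a b c d → (a ℤ.+ b) ℤ.+ (c ℤ.+ d) ≡ (a ℤ.+ c) ℤ.+ (b ℤ.+ d)
  interchange = ℤ-Solver.solve-∀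

sumℤ-*ʳ : ∀ n (F : Fin n → ℤ) K → sumℤ n (λ i → F i ℤ.* K) ≡ sumℤ n F ℤ.* K
sumℤ-*ʳ zero    F K = refl
sumℤ-*ʳ (suc n) F K =
  trans (cong (ℤ._+_ (F zero ℤ.* K)) (sumℤ-*ʳ n (F ∘ suc) K))
        (sym (ℤₚ.*-distribʳ-+ K (F zero) (sumℤ n (F ∘ suc))))

sumℤ-differAt : ∀ {n} {F G : Fin n → ℤ} i δ → (∀ j → j ≢ i → F j ≡ G j) →
                F i ≡ δ ℤ.+ G i → sumℤ n F ≡ δ ℤ.+ sumℤ n G
sumℤ-differAt {suc n} {F} {G} zero δ F≗G Fi≡δ+Gi = begin
  F zero ℤ.+ sumℤ n (F ∘ suc)
    ≡⟨ cong₂ ℤ._+_ Fi≡δ+Gi (sumℤ-cong n (λ j → F≗G (suc j) λ ())) ⟩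
  (δ ℤ.+ G zero) ℤ.+ sumℤ n (G ∘ suc)
    ≡⟨ ℤₚ.+-assoc δ (G zero) _ ⟩
  δ ℤ.+ sumℤ (suc n) G ∎
sumℤ-differAt {suc n} {F} {G} (suc i) δ F≗G Fi≡δ+Gi = begin
  F zero ℤ.+ sumℤ n (F ∘ suc)
    ≡⟨ cong₂ ℤ._+_ (F≗G zero λ ()) (sumℤ-differAt i δ F∘suc≗G∘suc Fi≡δ+Gi) ⟩
  G zero ℤ.+ (δ ℤ.+ sumℤ n (G ∘ suc))
    ≡⟨ swap (G zero) δ _ ⟩
  δ ℤ.+ sumℤ (suc n) G ∎
  where
  F∘suc≗G∘suc : ∀ j → j ≢ i → F (suc j) ≡ G (suc j)
  F∘suc≗G∘suc j j≢i = F≗G (suc j) (j≢i ∘ suc-injective)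
  swap : ∀ a b c → a ℤ.+ (b ℤ.+ c) ≡ b ℤ.+ (a ℤ.+ c)
  swap = ℤ-Solver.solve-∀

∣-sumℤ : ∀ {d} n {F : Fin n → ℤ} → (∀ i → d ∣ₛ F i) → d ∣ₛ sumℤ n F
∣-sumℤ zero    d∣F = divides (+ 0) refl
∣-sumℤ (suc n) d∣F = ∣m∣n⇒∣m+n (d∣F zero) (∣-sumℤ n (d∣F ∘ suc))

prime∤1 : ∀ {p} → Prime p → ¬ p ∣ 1
prime∤1 p-prime p∣1 = ¬prime[1] (subst Prime (ℕ∣.∣1⇒≡1 p∣1) p-prime)

euclidsLemmaℤ : ∀ {p} → Prime p → ∀ {a b} → + p ∣ₛ a ℤ.* b → + p ∣ₛ a ⊎ + p ∣ₛ b
euclidsLemmaℤ p-prime {a} {b} p∣ab = Sum.map ∣ᵤ⇒∣ ∣ᵤ⇒∣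
  (euclidsLemma ℤ.∣ a ∣ ℤ.∣ b ∣ p-prime (subst (_ ∣_) (ℤₚ.abs-* a b) (∣⇒∣ᵤ p∣ab)))

∣m*n∧∤n⇒∣m : ∀ {p} → Prime p → ∀ {a b} → + p ∣ₛ a ℤ.* b → ¬ + p ∣ₛ b → + p ∣ₛ a
∣m*n∧∤n⇒∣m p-prime p∣ab p∤b = [ id , ⊥-elim ∘ p∤b ]′ (euclidsLemmaℤ p-prime p∣ab)

prime∤prodℤ : ∀ {p} → Prime p → ∀ r {G : Fin r → ℤ} →
              (∀ t → ¬ + p ∣ₛ G t) → ¬ + p ∣ₛ prodℤ r G
prime∤prodℤ p-prime zero    _   p∣1 = prime∤1 p-prime (∣⇒∣ᵤ p∣1)
prime∤prodℤ p-prime (suc r) p∤G p∣∏ =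
  [ p∤G zero , prime∤prodℤ p-prime r (p∤G ∘ suc) ]′ (euclidsLemmaℤ p-prime p∣∏)

weight : ∀ {N} → (Fin N → Bool) → ℤ
weight {N} w = sumℤ N (λ j → bit (w j))

linearForm : ∀ {N} → (Fin N → ℤ) → (Fin N → Bool) → ℤ
linearForm {N} d w = sumℤ N (λ j → d j ℤ.* bit (w j))

linearForm-empty : ∀ {N} (d : Fin N → ℤ) → linearForm d (const false) ≡ + 0
linearForm-empty {N} d = trans (sumℤ-cong N (ℤₚ.*-zeroʳ ∘ d)) (sumℤ-zero N)

_[_]≔_ : ∀ {N} → (Fin N → Bool) → Fin N → Bool → Fin N → Bool
w [ z ]≔ β = updateAt w z (const β)

record SwitchedAt {N} (z : Fin N) (on off : Fin N → Bool) : Set where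
  field
    on-at  : on z ≡ true
    off-at : off z ≡ false
    agree  : ∀ j → j ≢ z → on j ≡ off j

switchedAt-update : ∀ {N} (w : Fin N → Bool) z →
                    SwitchedAt z (w [ z ]≔ true) (w [ z ]≔ false)
switchedAt-update w z = record
  { on-at  = updateAt-updates z w
  ; off-at = updateAt-updates z w
  ; agree  = λ j j≢z → trans (updateAt-minimal j z w j≢z) (sym (updateAt-minimal j z w j≢z))
  }

switchedAt-clear : ∀ {N} (w : Fin N → Bool) z → w z ≡ true → SwitchedAt z w (w [ z ]≔ false)
switchedAt-clear w z wz = record
  { on-at  = wz
  ; off-at = updateAt-updates z w
  ; agree  = λ j j≢z → sym (updateAt-minimal j z w j≢z)
  }

switchedAt-set : ∀ {N} (w : Fin N → Bool) z → w z ≡ false → SwitchedAt z (w [ z ]≔ true) w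
switchedAt-set w z wz = record
  { on-at  = updateAt-updates z w
  ; off-at = wz
  ; agree  = λ j j≢z → updateAt-minimal j z w j≢z
  }

module _ {N} {z : Fin N} {on off : Fin N → Bool} (sw : SwitchedAt z on off) where
  open SwitchedAt sw

  weight-switched : weight on ≡ + 1 ℤ.+ weight off
  weight-switched = sumℤ-differAt z (+ 1) (λ j → cong bit ∘ agree j)
    (trans (cong bit on-at) (cong (ℤ._+_ (+ 1) ∘ bit) (sym off-at)))

  linearForm-switched : ∀ d → linearForm d on ≡ d z ℤ.+ linearForm d off
  linearForm-switched d =
    sumℤ-differAt z (d z) (λ j → cong (λ u → d j ℤ.* bit u) ∘ agree j) at-z
    where
    at-z : d z ℤ.* bit (on z) ≡ d z ℤ.+ d z ℤ.* bit (off z)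
    at-z rewrite on-at | off-at = times-bits (d z)
      where
      times-bits : ∀ x → x ℤ.* + 1 ≡ x ℤ.+ x ℤ.* + 0
      times-bits = ℤ-Solver.solve-∀

prefix : ∀ {N} → ℕ → Fin N → Bool
prefix zero    _       = false
prefix (suc a) zero    = true
prefix (suc a) (suc j) = prefix a j

prefix-true : ∀ {N} a (j : Fin N) → toℕ j < a → prefix a j ≡ true
prefix-true (suc a) zero    _         = refl
prefix-true (suc a) (suc j) (s≤s j<a) = prefix-true a j j<a

prefix-false : ∀ {N} a (j : Fin N) → a ≤ toℕ j → prefix a j ≡ false
prefix-false zero    _       _         = refl
prefix-false (suc a) (suc j) (s≤s a≤j) = prefix-false a j a≤j

weight-prefix : ∀ {N} a → a ≤ N → weight (prefix {N} a) ≡ + a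
weight-prefix {zero}  zero    _         = refl
weight-prefix {suc N} zero    _         = sumℤ-zero (suc N)
weight-prefix {suc N} (suc a) (s≤s a≤N) = cong (ℤ._+_ (+ 1)) (weight-prefix a a≤N)

∃-containing-weight : ∀ {N} m (y : Fin N) → m < N → ∃[ C ] C y ≡ true × weight C ≡ + suc m
∃-containing-weight m y m<N with toℕ y ℕ.<? suc m
... | yes y<1+m = prefix (suc m) , prefix-true (suc m) y y<1+m , weight-prefix (suc m) m<N
... | no  y≮1+m = prefix m [ y ]≔ true , updateAt-updates y (prefix m) ,
                  trans (weight-switched (switchedAt-set (prefix m) y y∉prefix))
                        (cong (ℤ._+_ (+ 1)) (weight-prefix m (ℕ.<⇒≤ m<N)))
  where
  y∉prefix : prefix m y ≡ false
  y∉prefix = prefix-false m y (ℕ.<⇒≤ (ℕ.≮⇒≥ y≮1+m))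

sumℤ-deletions : ∀ {N} (d : Fin N → ℤ) (C : Fin N → Bool) →
                 weight C ℤ.* linearForm d C ≡
                 sumℤ N (λ z → bit (C z) ℤ.* linearForm d (C [ z ]≔ false)) ℤ.+ linearForm d C
sumℤ-deletions {N} d C = begin
  weight C ℤ.* linearForm d C
    ≡⟨ sumℤ-*ʳ N (bit ∘ C) (linearForm d C) ⟨
  sumℤ N (λ z → bit (C z) ℤ.* linearForm d C)
    ≡⟨ sumℤ-cong N (λ z → deletion z (C z) refl) ⟩
  sumℤ N (λ z → bit (C z) ℤ.* linearForm d (C [ z ]≔ false) ℤ.+ d z ℤ.* bit (C z))
    ≡⟨ sumℤ-distrib-+ N _ _ ⟩
  sumℤ N (λ z → bit (C z) ℤ.* linearForm d (C [ z ]≔ false)) ℤ.+ linearForm d C ∎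
  where
  deletion : ∀ z β → C z ≡ β → bit β ℤ.* linearForm d C ≡
             bit β ℤ.* linearForm d (C [ z ]≔ false) ℤ.+ d z ℤ.* bit β
  deletion z true  Cz =
    trans (cong (ℤ._*_ (+ 1)) (linearForm-switched (switchedAt-clear C z Cz) d)) (shift (d z) _)
    where
    shift : ∀ x L → + 1 ℤ.* (x ℤ.+ L) ≡ + 1 ℤ.* L ℤ.+ x ℤ.* + 1
    shift = ℤ-Solver.solve-∀
  deletion z false _ = sym (trans (ℤₚ.+-identityˡ _) (ℤₚ.*-zeroʳ (d z)))

-- Summed over the m-subsets C ∖ z of an (m + 1)-set C ∋ y, the form takes the value m times its
-- value on C, so p divides the latter; d y is the difference of its values on C and C ∖ y.
∣-linearForm⇒∣-coefficients : ∀ {p N m} → Prime p → (d : Fin N → ℤ) → ¬ + p ∣ₛ + m → m < N →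
                              (∀ w → weight w ≡ + m → + p ∣ₛ linearForm d w) → ∀ y → + p ∣ₛ d y
∣-linearForm⇒∣-coefficients {p} {N} {m} p-prime d p∤m m<N p∣L y
  with ∃-containing-weight m y m<N
... | C , Cy , |C| = ∣m+n∣n⇒∣m
  (subst (_ ∣ₛ_) (linearForm-switched (switchedAt-clear C y Cy) d) p∣L[C]) (p∣deletion y Cy)
  where
  p∣deletion : ∀ z → C z ≡ true → + p ∣ₛ linearForm d (C [ z ]≔ false)
  p∣deletion z Cz = p∣L _
    (+-cancelˡ (+ 1) _ _ (trans (sym (weight-switched (switchedAt-clear C z Cz))) |C|))

  deletions : ℤ
  deletions = sumℤ N (λ z → bit (C z) ℤ.* linearForm d (C [ z ]≔ false))

  p∣deletions : + p ∣ₛ deletions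
  p∣deletions = ∣-sumℤ N term
    where
    term : ∀ z → + p ∣ₛ bit (C z) ℤ.* linearForm d (C [ z ]≔ false)
    term z with C z in Cz
    ... | true  = ∣n⇒∣m*n (+ 1) (p∣deletion z Cz)
    ... | false = divides (+ 0) refl

  p∣L[C] : + p ∣ₛ linearForm d C
  p∣L[C] = ∣m*n∧∤n⇒∣m p-prime (subst (_ ∣ₛ_) deletions≡L*m p∣deletions) p∤m
    where
    deletions≡L*m : deletions ≡ linearForm d C ℤ.* + m
    deletions≡L*m = +-cancelʳ (linearForm d C) _ _ (begin
      deletions ℤ.+ linearForm d C ≡⟨ sumℤ-deletions d C ⟨
      weight C ℤ.* linearForm d C  ≡⟨ cong (ℤ._* linearForm d C) |C| ⟩
      + suc m ℤ.* linearForm d C   ≡⟨ regroup (+ m) (linearForm d C) ⟩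
      linearForm d C ℤ.* + m ℤ.+ linearForm d C ∎)
      where
      regroup : ∀ m L → (+ 1 ℤ.+ m) ℤ.* L ≡ L ℤ.* m ℤ.+ L
      regroup = ℤ-Solver.solve-∀

qInt : ℕ → ℕ → ℕ
qInt q d = qbin q d 1

qbin-zero : ∀ q a → qbin q a 0 ≡ 1
qbin-zero q zero    = refl
qbin-zero q (suc a) = refl

qInt-suc : ∀ q a → qInt q (suc a) ≡ 1 + q * qInt q a
qInt-suc q a rewrite qbin-zero q a | ℕ.*-identityʳ q = refl

qInt-+ : ∀ q a d → qInt q (a + d) ≡ qInt q a + q ^ a * qInt q d
qInt-+ q zero    d = sym (ℕ.+-identityʳ (qInt q d))
qInt-+ q (suc a) d = begin
  qInt q (suc (a + d))                     ≡⟨ qInt-suc q (a + d) ⟩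
  1 + q * qInt q (a + d)                   ≡⟨ cong (λ u → 1 + q * u) (qInt-+ q a d) ⟩
  1 + q * (qInt q a + q ^ a * qInt q d)    ≡⟨ distribute q (qInt q a) (q ^ a) (qInt q d) ⟩
  (1 + q * qInt q a) + q * q ^ a * qInt q d ≡⟨ cong (_+ q * q ^ a * qInt q d) (qInt-suc q a) ⟨
  qInt q (suc a) + q ^ suc a * qInt q d    ∎
  where
  distribute : ∀ q x y z → 1 + q * (x + y * z) ≡ (1 + q * x) + q * y * z
  distribute = ℕ-Solver.solve-∀

qInt-pow : ∀ q′ d → 1 + q′ * qInt (suc q′) d ≡ suc q′ ^ d
qInt-pow q′ zero    = cong suc (ℕ.*-zeroʳ q′)
qInt-pow q′ (suc d) = begin
  1 + q′ * qInt (suc q′) (suc d)          ≡⟨ cong (λ u → 1 + q′ * u) (qInt-suc (suc q′) d) ⟩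
  1 + q′ * (1 + suc q′ * qInt (suc q′) d) ≡⟨ factor q′ (qInt (suc q′) d) ⟩
  suc q′ * (1 + q′ * qInt (suc q′) d)     ≡⟨ cong (suc q′ *_) (qInt-pow q′ d) ⟩
  suc q′ * suc q′ ^ d                     ∎
  where
  factor : ∀ r x → 1 + r * (1 + (1 + r) * x) ≡ (1 + r) * (1 + r * x)
  factor = ℕ-Solver.solve-∀

qInt-mono-≤ : ∀ q {a c} → a ≤ c → qInt q a ≤ qInt q c
qInt-mono-≤ q {a} a≤c with ℕ.m≤n⇒∃[o]m+o≡n a≤c
... | e , refl = subst (qInt q a ≤_) (sym (qInt-+ q a e)) (ℕ.m≤m+n (qInt q a) _)

qInt-mono-< : ∀ q′ {a c} → a < c → qInt (suc q′) a < qInt (suc q′) c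
qInt-mono-< q′ {a} {c} a<c =
  ℕ.<-≤-trans (s≤s (ℕ.m≤n*m (qInt (suc q′) a) (suc q′)))
              (subst (_≤ qInt (suc q′) c) (qInt-suc (suc q′) a) (qInt-mono-≤ (suc q′) a<c))

interval-not-covered : ∀ {r} (k : Fin r → ℕ) a →
                       ¬ (∀ (i : Fin (suc r)) → ∃[ t ] k t ≡ a + toℕ i)
interval-not-covered {r} k a covers with pigeonhole (ℕ.n<1+n r) (proj₁ ∘ covers)
... | i , i′ , i<i′ , same-t = ℕ.<⇒≢ i<i′ (ℕ.+-cancelˡ-≡ a _ _ (begin
  a + toℕ i             ≡⟨ proj₂ (covers i) ⟨
  k (proj₁ (covers i))  ≡⟨ cong k same-t ⟩
  k (proj₁ (covers i′)) ≡⟨ proj₂ (covers i′) ⟩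
  a + toℕ i′            ∎))

∃-unattained : ∀ {r} (k : Fin r → ℕ) a → ∃[ j ] a ≤ j × j ≤ a + r × (∀ t → k t ≢ j)
∃-unattained {r} k a with any? (λ (i : Fin (suc r)) → ¬? (any? (λ t → k t ℕ.≟ a + toℕ i)))
... | yes (i , unattained) = a + toℕ i , ℕ.m≤m+n a (toℕ i) , ℕ.+-monoʳ-≤ a (toℕ≤pred[n] i) ,
                             λ t kt≡j → unattained (t , kt≡j)
... | no  all-attained = contradiction covers (interval-not-covered k a)
  where
  covers : ∀ i → ∃[ t ] k t ≡ a + toℕ i
  covers i = decidable-stable (any? (λ t → k t ℕ.≟ a + toℕ i))
                              (λ unattained → all-attained (i , unattained))

∃-unattained-above-1 : ∀ {r s n} (k : Fin (suc r) → ℕ) → (∀ t → s + k t ≤ n) → suc r < s →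
                       ∃[ j ] 1 ≤ j × j ≤ suc (suc r) × j < n × (∀ t → k t ≢ j)
∃-unattained-above-1 {r} {s} {n} k s+k≤n 1+r<s with any? (λ t → k t ℕ.≟ 1)
... | no  1-unattained = 1 , ℕ.≤-refl , s≤s z≤n , 1<n , λ t kt≡1 → 1-unattained (t , kt≡1)
  where
  1<n : 1 < n
  1<n = ℕ.≤-trans (ℕ.≤-trans (s≤s (s≤s z≤n)) 1+r<s) (ℕ.m+n≤o⇒m≤o s (s+k≤n zero))
... | yes (t , kt≡1) with ∃-unattained k 1
...   | j , 1≤j , j≤2+r , unattained = j , 1≤j , j≤2+r , j<n , unattained
  where
  j<n : j < n
  j<n = ℕ.≤-<-trans (ℕ.≤-trans j≤2+r 1+r<s) s<n
    where
    s<n : s < n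
    s<n = subst (_≤ n) (ℕ.+-comm s 1) (subst (λ i → s + i ≤ n) kt≡1 (s+k≤n t))

levelFactor : ℕ → ∀ {r} → (Fin r → ℕ) → ℤ → ℤ
levelFactor q {r} k ℓ = prodℤ r (λ t → ℓ ℤ.- + qInt q (k t))

module Cube (q n : ℕ) where

  update : ∀ {s} → Ω q n s → (x : Fin (suc s)) → Fin (qbin q n (toℕ x)) → Bool → Ω q n s
  update v x y β x′ with x Fin.≟ x′
  ... | yes refl = v x [ y ]≔ β
  ... | no  _    = v x′

  update-here : ∀ {s} (v : Ω q n s) x y β → update v x y β x ≡ v x [ y ]≔ β
  update-here v x y β with x Fin.≟ x
  ... | yes refl = refl
  ... | no  x≢x  = contradiction refl x≢x

  update-elsewhere : ∀ {s} (v : Ω q n s) x y β x′ → x ≢ x′ → update v x y β x′ ≡ v x′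
  update-elsewhere v x y β x′ x≢x′ with x Fin.≟ x′
  ... | yes x≡x′ = contradiction x≡x′ x≢x′
  ... | no  _    = refl

  level1Sum-update : ∀ {s} (v : Ω q n (suc s)) x y β → x ≢ suc zero →
                     level1Sum q n (suc s) (update v x y β) ≡ level1Sum q n (suc s) v
  level1Sum-update v x y β x≢1 =
    cong (λ u → sumℤ _ (λ j → bit (u j))) (update-elsewhere v x y β (suc zero) x≢1)

  levelOne : ∀ {s} → (Fin (qbin q n 1) → Bool) → Ω q n (suc s)
  levelOne w zero          = const false
  levelOne w (suc zero)    = w
  levelOne w (suc (suc _)) = const false

module Combination (q n s : ℕ) {r} (k : Fin r → ℕ)
                   (c : (x : Fin (suc s)) → Fin (qbin q n (toℕ x)) → ℤ) where

  open Cube q n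

  levelTerm : (x : Fin (suc s)) → (Fin (qbin q n (toℕ x)) → Bool) → ℤ
  levelTerm x u = if does (toℕ x + r ℕ.≤? s) then linearForm (c x) u else + 0

  linearPart : Ω q n s → ℤ
  linearPart v = sumℤ (suc s) (λ x → levelTerm x (v x))

  levelTerm-active : ∀ {x} → toℕ x + r ≤ s → ∀ u → levelTerm x u ≡ linearForm (c x) u
  levelTerm-active {x} x+r≤s u =
    cong (if_then linearForm (c x) u else + 0) (dec-true (_ ℕ.≤? s) x+r≤s)

  combo-factorises : ∀ v → combo q n s k c v ≡ linearPart v ℤ.* levelFactor q k (level1Sum q n s v)
  combo-factorises v =
    trans (sumℤ-cong (suc s) (λ x → summand (does (toℕ x + r ℕ.≤? s)) x))
          (sumℤ-*ʳ (suc s) (λ x → levelTerm x (v x)) P)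
    where
    P = levelFactor q k (level1Sum q n s v)
    summand : ∀ β x → (if β then sumℤ _ (λ y → c x y ℤ.* g q n s k x y v) else + 0) ≡
                      (if β then linearForm (c x) (v x) else + 0) ℤ.* P
    summand true  x = trans (sumℤ-cong _ (λ y → sym (ℤₚ.*-assoc (c x y) (bit (v x y)) P)))
                            (sumℤ-*ʳ _ (λ y → c x y ℤ.* bit (v x y)) P)
    summand false x = refl

  linearPart-toggle : ∀ v x y → toℕ x + r ≤ s →
                      linearPart (update v x y true) ≡ c x y ℤ.+ linearPart (update v x y false)
  linearPart-toggle v x y x+r≤s =
    sumℤ-differAt {F = λ x′ → levelTerm x′ (update v x y true x′)} x (c x y) elsewhere here
    where
    elsewhere : ∀ x′ → x′ ≢ x →
                levelTerm x′ (update v x y true x′) ≡ levelTerm x′ (update v x y false x′)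
    elsewhere x′ x′≢x = cong (levelTerm x′) (trans (update-elsewhere v x y true x′ (x′≢x ∘ sym))
                                                   (sym (update-elsewhere v x y false x′ (x′≢x ∘ sym))))
    here : levelTerm x (update v x y true x) ≡ c x y ℤ.+ levelTerm x (update v x y false x)
    here = begin
      levelTerm x (update v x y true x)
        ≡⟨ levelTerm-active x+r≤s _ ⟩
      linearForm (c x) (update v x y true x)
        ≡⟨ cong (linearForm (c x)) (update-here v x y true) ⟩
      linearForm (c x) (v x [ y ]≔ true)
        ≡⟨ linearForm-switched (switchedAt-update (v x) y) (c x) ⟩
      c x y ℤ.+ linearForm (c x) (v x [ y ]≔ false)
        ≡⟨ cong (ℤ._+_ (c x y) ∘ linearForm (c x)) (update-here v x y false) ⟨
      c x y ℤ.+ linearForm (c x) (update v x y false x)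
        ≡⟨ cong (ℤ._+_ (c x y)) (levelTerm-active x+r≤s _) ⟨
      c x y ℤ.+ levelTerm x (update v x y false x) ∎

  ∣-coefficient-by-toggling : ∀ {d} v x y → toℕ x + r ≤ s →
                              (∀ β → d ∣ₛ linearPart (update v x y β)) → d ∣ₛ c x y
  ∣-coefficient-by-toggling v x y x+r≤s d∣ =
    ∣m+n∣n⇒∣m (subst (_ ∣ₛ_) (linearPart-toggle v x y x+r≤s) (d∣ true)) (d∣ false)

linearPart-levelOne : ∀ {q n s r} (k : Fin r → ℕ)
                      (c : (x : Fin (suc (suc s))) → Fin (qbin q n (toℕ x)) → ℤ) → r < suc s → ∀ w →
                      Combination.linearPart q n (suc s) k c (Cube.levelOne q n w) ≡ linearForm (c (suc zero)) w
linearPart-levelOne {q} {n} {s} {r} k c r<1+s w = begin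
  levelTerm zero (const false) ℤ.+
    (levelTerm (suc zero) w ℤ.+ sumℤ s (λ x → levelTerm (suc (suc x)) (const false)))
    ≡⟨ cong₂ (λ a b → a ℤ.+ (levelTerm (suc zero) w ℤ.+ b))
             (inactive zero) (trans (sumℤ-cong s (λ x → inactive (suc (suc x)))) (sumℤ-zero s)) ⟩
  + 0 ℤ.+ (levelTerm (suc zero) w ℤ.+ + 0)
    ≡⟨ trans (ℤₚ.+-identityˡ _) (ℤₚ.+-identityʳ _) ⟩
  levelTerm (suc zero) w
    ≡⟨ levelTerm-active r<1+s w ⟩
  linearForm (c (suc zero)) w ∎
  where
  open Combination q n (suc s) k c
  inactive : ∀ x → levelTerm x (const false) ≡ + 0
  inactive x with toℕ x + r ≤ᵇ suc s
  ... | true  = linearForm-empty (c x)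
  ... | false = refl

coefficient-∣-without-factor : ∀ {q n s p} (k : Fin 0 → ℕ)
                               (c : (x : Fin (suc s)) → Fin (qbin q n (toℕ x)) → ℤ) →
                               (∀ v → + p ∣ₛ combo q n s k c v) →
                               ∀ x y → toℕ x + 0 ≤ s → + p ∣ₛ c x y
coefficient-∣-without-factor {q} {n} {s} k c p∣combo x y x≤s =
  ∣-coefficient-by-toggling v₀ x y x≤s (λ β → p∣linearPart (update v₀ x y β))
  where
  open Cube q n
  open Combination q n s k c
  v₀ : Ω q n s
  v₀ _ _ = false
  p∣linearPart : ∀ v → _ ∣ₛ linearPart v
  p∣linearPart v = subst (_ ∣ₛ_) (trans (combo-factorises v) (ℤₚ.*-identityʳ _)) (p∣combo v)

r≤r*[1+s∸r] : ∀ {r s} → r ≤ s → r ≤ r * (suc s ∸ r)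
r≤r*[1+s∸r] {r} {s} r≤s = subst (_≤ r * (suc s ∸ r)) (ℕ.*-identityʳ r)
  (ℕ.*-monoʳ-≤ r (ℕ.m+n≤o⇒m≤o∸n 1 (s≤s r≤s)))

r+r≤r*[1+s∸r] : ∀ {r s} → r < s → r + r ≤ r * (suc s ∸ r)
r+r≤r*[1+s∸r] {r} {s} r<s = subst (_≤ r * (suc s ∸ r)) (double r)
  (ℕ.*-monoʳ-≤ r (ℕ.m+n≤o⇒m≤o∸n 2 (s≤s r<s)))
  where
  double : ∀ r → r * 2 ≡ r + r
  double = ℕ-Solver.solve-∀

module PrimitiveDivisor {q′ b p : ℕ} (p-prime : Prime p) (1≤b : 1 ≤ b)
  (p∣q^b∸1 : p ∣ suc q′ ^ b ∸ 1) (p∤q^i∸1 : ∀ i → 0 < i → i < b → ¬ p ∣ suc q′ ^ i ∸ 1) where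

  q : ℕ
  q = suc q′

  p∤q : ¬ p ∣ q
  p∤q p∣q = prime∤1 p-prime (ℕ∣.∣m+n∣m⇒∣n p∣[q^b∸1]+1 p∣q^b∸1)
    where
    p∣q^ : ∀ {a} → 1 ≤ a → p ∣ q ^ a
    p∣q^ {suc a} _ = ℕ∣.∣m⇒∣m*n (q ^ a) p∣q
    p∣[q^b∸1]+1 : p ∣ (q ^ b ∸ 1) + 1
    p∣[q^b∸1]+1 = subst (p ∣_) (sym (ℕ.m∸n+n≡m (ℕ.m^n>0 q b))) (p∣q^ 1≤b)

  p∤q^ : ∀ a → ¬ p ∣ q ^ a
  p∤q^ zero    = prime∤1 p-prime
  p∤q^ (suc a) = [ p∤q , p∤q^ a ]′ ∘ euclidsLemma q (q ^ a) p-prime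

  p∤qInt : ∀ {d} → 0 < d → d < b → ¬ p ∣ qInt q d
  p∤qInt {d} 0<d d<b p∣[d] =
    p∤q^i∸1 d 0<d d<b (subst (p ∣_) (cong (_∸ 1) (qInt-pow q′ d)) (ℕ∣.∣n⇒∣m*n q′ p∣[d]))

  p∤qInt-qInt< : ∀ {j k} → k < j → j < b → ¬ + p ∣ₛ + qInt q j ℤ.- + qInt q k
  p∤qInt-qInt< {j} {k} k<j j<b p∣[j]-[k] =
    [ p∤q^ k , p∤qInt (ℕ.m<n⇒0<n∸m k<j) (ℕ.≤-<-trans (ℕ.m∸n≤m j k) j<b) ]′
      (euclidsLemma (q ^ k) (qInt q (j ∸ k)) p-prime (∣⇒∣ᵤ (subst (+ p ∣ₛ_) difference p∣[j]-[k])))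
    where
    difference : + qInt q j ℤ.- + qInt q k ≡ + (q ^ k * qInt q (j ∸ k))
    difference = begin
      + qInt q j ℤ.- + qInt q k
        ≡⟨ cong (λ i → + qInt q i ℤ.- + qInt q k) (ℕ.m+[n∸m]≡n (ℕ.<⇒≤ k<j)) ⟨
      + qInt q (k + (j ∸ k)) ℤ.- + qInt q k
        ≡⟨ cong (λ i → + i ℤ.- + qInt q k) (qInt-+ q k (j ∸ k)) ⟩
      + (qInt q k + q ^ k * qInt q (j ∸ k)) ℤ.- + qInt q k
        ≡⟨ cong (ℤ._- + qInt q k) (ℤₚ.pos-+ (qInt q k) _) ⟩
      (+ qInt q k ℤ.+ + (q ^ k * qInt q (j ∸ k))) ℤ.- + qInt q k
        ≡⟨ cancel (+ qInt q k) _ ⟩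
      + (q ^ k * qInt q (j ∸ k)) ∎
      where
      cancel : ∀ x y → (x ℤ.+ y) ℤ.- x ≡ y
      cancel = ℤ-Solver.solve-∀

  p∤qInt-qInt : ∀ {j k} → j < b → k < b → j ≢ k → ¬ + p ∣ₛ + qInt q j ℤ.- + qInt q k
  p∤qInt-qInt {j} {k} j<b k<b j≢k with ℕ.<-cmp j k
  ... | tri< j<k _ _ =
    p∤qInt-qInt< j<k k<b ∘ subst (+ p ∣ₛ_) (negate (+ qInt q j) (+ qInt q k)) ∘ ∣m⇒∣-m
    where
    negate : ∀ x y → ℤ.- (x ℤ.- y) ≡ y ℤ.- x
    negate = ℤ-Solver.solve-∀
  ... | tri≈ _ j≡k _ = contradiction j≡k j≢k
  ... | tri> _ _ k<j = p∤qInt-qInt< k<j j<b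

  p∤levelFactor : ∀ {r} {k : Fin r → ℕ} {j} → (∀ t → k t < b) → j < b → (∀ t → k t ≢ j) →
                  ¬ + p ∣ₛ levelFactor q k (+ qInt q j)
  p∤levelFactor {r} k<b j<b unattained =
    prime∤prodℤ p-prime r (λ t → p∤qInt-qInt j<b (k<b t) (unattained t ∘ sym))

  ≤b∸1⇒<b : ∀ {m} → m ≤ b ∸ 1 → m < b
  ≤b∸1⇒<b = ℕ.m≤pred[n]⇒suc[m]≤n {{>-nonZero 1≤b}}

  coefficient-∣-off-level-one : ∀ {n r s} (k : Fin r → ℕ) → (∀ t → k t < b) →
    ∀ {j} → j < b → j ≤ n → (∀ t → k t ≢ j) →
    (c : (x : Fin (suc (suc s))) → Fin (qbin q n (toℕ x)) → ℤ) →
    (∀ v → + p ∣ₛ combo q n (suc s) k c v) →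
    ∀ x y → toℕ x + r ≤ suc s → x ≢ suc zero → + p ∣ₛ c x y
  coefficient-∣-off-level-one {n} {r} {s} k k<b {j} j<b j≤n unattained c p∣combo x y x+r≤s x≢1 =
    ∣-coefficient-by-toggling v₀ x y x+r≤s p∣linearPart
    where
    open Cube q n
    open Combination q n (suc s) k c
    v₀ : Ω q n (suc s)
    v₀ = levelOne (prefix (qInt q j))
    p∣linearPart : ∀ β → + p ∣ₛ linearPart (update v₀ x y β)
    p∣linearPart β = ∣m*n∧∤n⇒∣m p-prime
      (subst (+ p ∣ₛ_) factorisation (p∣combo (update v₀ x y β))) (p∤levelFactor k<b j<b unattained)
      where
      factorisation : combo q n (suc s) k c (update v₀ x y β) ≡
                      linearPart (update v₀ x y β) ℤ.* levelFactor q k (+ qInt q j)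
      factorisation =
        trans (combo-factorises (update v₀ x y β))
              (cong (λ ℓ → linearPart (update v₀ x y β) ℤ.* levelFactor q k ℓ)
                    (trans (level1Sum-update v₀ x y β x≢1) (weight-prefix _ (qInt-mono-≤ q j≤n))))

  coefficient-∣-on-level-one : ∀ {n r s} (k : Fin r → ℕ) → (∀ t → k t < b) →
    ∀ {j} → 1 ≤ j → j < b → j < n → (∀ t → k t ≢ j) →
    (c : (x : Fin (suc (suc s))) → Fin (qbin q n (toℕ x)) → ℤ) →
    (∀ v → + p ∣ₛ combo q n (suc s) k c v) →
    r < suc s → ∀ y → + p ∣ₛ c (suc zero) y
  coefficient-∣-on-level-one {n} {r} {s} k k<b {j} 1≤j j<b j<n unattained c p∣combo r<1+s =
    ∣-linearForm⇒∣-coefficients p-prime (c (suc zero)) (p∤qInt 1≤j j<b ∘ ∣⇒∣ᵤ) (qInt-mono-< q′ j<n)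
      p∣linearForm
    where
    open Cube q n
    open Combination q n (suc s) k c
    p∣linearForm : ∀ w → weight w ≡ + qInt q j → + p ∣ₛ linearForm (c (suc zero)) w
    p∣linearForm w |w| = ∣m*n∧∤n⇒∣m p-prime
      (subst (+ p ∣ₛ_) factorisation (p∣combo (levelOne w))) (p∤levelFactor k<b j<b unattained)
      where
      factorisation : combo q n (suc s) k c (levelOne w) ≡
                      linearForm (c (suc zero)) w ℤ.* levelFactor q k (+ qInt q j)
      factorisation =
        trans (combo-factorises (levelOne w))
              (cong₂ ℤ._*_ (linearPart-levelOne {q} {n} k c r<1+s w) (cong (levelFactor q k) |w|))

  coefficient-∣ : ∀ {n r s} (k : Fin r → ℕ) → (∀ t → k t < b) → (∀ t → s + k t ≤ n) →
    r * (suc s ∸ r) ≤ b ∸ 1 →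
    (c : (x : Fin (suc s)) → Fin (qbin q n (toℕ x)) → ℤ) → (∀ v → + p ∣ₛ combo q n s k c v) →
    ∀ x y → toℕ x + r ≤ s → + p ∣ₛ c x y
  coefficient-∣ {n} {zero} k _ _ _ c p∣combo = coefficient-∣-without-factor {q} {n} k c p∣combo
  coefficient-∣ {_} {suc r} {zero} k _ _ _ c _ zero y ()
  coefficient-∣ {n} {suc r} {suc s} k k<b s+k≤n bound c p∣combo x y x+r≤s with x Fin.≟ suc zero
  ... | yes refl with ∃-unattained-above-1 k s+k≤n x+r≤s
  ...   | j , 1≤j , j≤2+r , j<n , unattained =
    coefficient-∣-on-level-one k k<b 1≤j j<b j<n unattained c p∣combo x+r≤s y
    where
    j<b : j < b
    j<b = ≤b∸1⇒<b (ℕ.≤-trans (ℕ.≤-trans j≤2+r (s≤s (ℕ.m≤n+m (suc r) r)))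
                            (ℕ.≤-trans (r+r≤r*[1+s∸r] x+r≤s) bound))
  coefficient-∣ {n} {suc r} {suc s} k k<b s+k≤n bound c p∣combo x y x+r≤s | no x≢1
    with ∃-unattained k 0
  ...   | j , _ , j≤r , unattained =
    coefficient-∣-off-level-one k k<b j<b j≤n unattained c p∣combo x y x+r≤s x≢1
    where
    r≤s : suc r ≤ suc s
    r≤s = ℕ.m+n≤o⇒n≤o (toℕ x) x+r≤s
    j<b : j < b
    j<b = ≤b∸1⇒<b (ℕ.≤-trans j≤r (ℕ.≤-trans (r≤r*[1+s∸r] r≤s) bound))
    j≤n : j ≤ n
    j≤n = ℕ.≤-trans j≤r (ℕ.≤-trans r≤s (ℕ.m+n≤o⇒m≤o (suc s) (s+k≤n zero)))

-- IsPrimePower only serves to exclude q = 0; the conditions on μ, the monotonicity of k and the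
-- two Zsigmondy exceptions merely guarantee that p exists.
mainTheorem5 : (q n b r s p : ℕ) →
    IsPrimePower q →
    1 ≤ b →
    (k : Fin r → ℕ) → (μ : Fin s → ℕ) →
    (∀ i j → toℕ i < toℕ j → k i < k j) →
    (∀ i → k i < b) →
    (∀ i j → μ i ≡ μ j → i ≡ j) →
    (∀ i → μ i < b) →
    (∀ i j → k i ≢ μ j) →
    ¬ ((∃[ m ] (q + 1 ≡ 2 ^ m)) × b ≡ 2) →
    ¬ (q ≡ 2 × b ≡ 6) →
    Prime p →
    p ∣ (q ^ b ∸ 1) →
    (∀ i → 0 < i → i < b → ¬ (p ∣ (q ^ i ∸ 1))) →
    (∀ t → s + k t ≤ n) →
    r * (suc s ∸ r) ≤ b ∸ 1 →
    (c : (x : Fin (suc s)) → Fin (qbin q n (toℕ x)) → ℤ) →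
    (∀ (v : Ω q n s) → (+ p) ∣ℤ combo q n s k c v) →
    ∀ (x : Fin (suc s)) (y : Fin (qbin q n (toℕ x))) → toℕ x + r ≤ s →
    (+ p) ∣ℤ c x y
mainTheorem5 zero n b r s p (ℓ , e , ℓ-prime , _ , 0≡ℓ^e) =
  ⊥-elim (¬prime[0] (subst Prime (ℕ.m^n≡0⇒m≡0 ℓ e (sym 0≡ℓ^e)) ℓ-prime))
mainTheorem5 (suc q′) n b r s p _ 1≤b k _ _ k<b _ _ _ _ _ p-prime p∣q^b∸1 p∤q^i∸1
             s+k≤n bound c p∣combo x y x+r≤s =
  ∣⇒∣ᵤ (coefficient-∣ k k<b s+k≤n bound c (∣ᵤ⇒∣ ∘ p∣combo) x y x+r≤s)
  where
  open PrimitiveDivisor p-prime 1≤b p∣q^b∸1 p∤q^i∸1
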